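{- Let $G_1, G_2$ be groups and $G := G_1 \oplus G_2$. Let $x_1,\ldots,x_n, x_1',\ldots,x_n', y_1,\ldots,y_m, y_1',\ldots,y_m' \in G_1$ and $z_1,\ldots,z_m \in G_2$, and set \begin{align*} F_1 &:= ((x_1,1),\ldots,(x_n,1),(y_1,z_1),\ldots,(y_m,z_m)),\\ F_2 &:= ((x_1',1),\ldots,(x_n',1),(y_1',z_1),\ldots,(y_m',z_m)),\\ K &:= \langle x_1,\ldots,x_n,y_1,\ldots,y_m\rangle \le G_1, \end{align*} and let $N$ be the normal closure of $\{x_1,\ldots,x_n\}$ inside $K$. \begin{enumerate} \item If $F_1 \cong_H F_2$ and $z_i \neq 1$ for all $i$, then there exists a permutation $\pi \in S_n$ such that for every $i$, $1\le i\le n$, $x_i'$ is conjugate to $x_{\pi(i)}$ in $K$ (in particular $x_i' \in N$). \item If in addition the stabilizer in $B_m$ (under the Hurwitz braid action) of $(z_1,\ldots,z_m)$ is contained in the stabilizer in $B_m$ of $(y_1,\ldots,y_m)$, then for every $i$, $1\le i\le m$, there exists an element $m_i\in N$ such that $y_i' = y_i^{m_i}$. \end{enumerate}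
   Context: For a group $G$, a $g$-factorization of length $n$ is a tuple $(f_1,\ldots,f_n)\in G^n$ with $f_1\cdots f_n=g$. The braid group $B_n$ (generators $\sigma_1,\ldots,\sigma_{n-1}$) acts on the right on factorizations of length $n$ by the Hurwitz braid action: $(f_1,\ldots,f_n)\sigma_i = (f_1,\ldots,f_{i-1},f_{i+1},f_{i+1}^{ -1}f_if_{i+1},f_{i+2},\ldots,f_n)$ and $(f_1,\ldots,f_n)\sigma_i^{ -1} = (f_1,\ldots,f_{i-1},f_if_{i+1}f_i^{ -1},f_i,f_{i+2},\ldots,f_n)$. Two factorizations are Hurwitz equivalent, written $\cong_H$, if they lie in the same orbit of this action. Conjugation convention: $a^b = b^{ -1}ab$. Here $F_1, F_2$ are factorizations in $G_1\oplus G_2$ with componentwise multiplication, acted on by $B_{n+m}$. -}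

module Defs where

open import Level using (Level; _⊔_)
open import Algebra.Bundles using (Group)
open import Data.Nat using (ℕ; zero; suc)
open import Data.Fin using (Fin; zero; suc)
open import Data.Vec using (Vec; []; _∷_)
open import Data.List using (List; []; _∷_)
open import Data.Empty using (⊥)
open import Data.Product using (_×_; _,_; Σ)
open import Data.Bool using (Bool; true; false)
open import Data.Vec.Relation.Binary.Pointwise.Inductive using (Pointwise)

module _ {c ℓ : Level} (G : Group c ℓ) where
  open Group G

  conj : Carrier → Carrier → Carrier
  conj a b = (b ⁻¹ ∙ a) ∙ b

  -- Hurwitz braid generators acting on factorizations of length k:
  -- B_0 has no generators; B_(suc n) has generators σ_i for i : Fin n
  -- (0-based; σ_i acts on positions i, i+1).  true = σ_i, false = σ_i⁻¹.
  BraidGen : ℕ → Set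
  BraidGen zero    = ⊥
  BraidGen (suc n) = Fin n × Bool

  BraidWord : ℕ → Set
  BraidWord k = List (BraidGen k)

  σ-act : ∀ {n} → Fin n → Bool → Vec Carrier (suc n) → Vec Carrier (suc n)
  σ-act zero    true  (a ∷ b ∷ r) = b ∷ conj a b ∷ r
  σ-act zero    false (a ∷ b ∷ r) = ((a ∙ b) ∙ a ⁻¹) ∷ a ∷ r
  σ-act (suc i) s     (a ∷ r)     = a ∷ σ-act i s r

  gen-act : ∀ {k} → Vec Carrier k → BraidGen k → Vec Carrier k
  gen-act {suc n} v (i , s) = σ-act i s v

  _·ʷ_ : ∀ {k} → Vec Carrier k → BraidWord k → Vec Carrier k
  v ·ʷ []      = v
  v ·ʷ (g ∷ w) = gen-act v g ·ʷ w

  _≈ᵛ_ : ∀ {k} → Vec Carrier k → Vec Carrier k → Set (c ⊔ ℓ)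
  _≈ᵛ_ = Pointwise _≈_

  _≅H_ : ∀ {k} → Vec Carrier k → Vec Carrier k → Set (c ⊔ ℓ)
  _≅H_ {k} F₁ F₂ = Σ (BraidWord k) λ w → (F₁ ·ʷ w) ≈ᵛ F₂

  InStab : ∀ {k} → Vec Carrier k → BraidWord k → Set (c ⊔ ℓ)
  InStab v w = (v ·ʷ w) ≈ᵛ v

  data InGen {i : Level} {I : Set i} (g : I → Carrier) : Carrier → Set (c ⊔ ℓ ⊔ i) where
    gen  : ∀ j → InGen g (g j)
    unit : InGen g ε
    inv  : ∀ {a} → InGen g a → InGen g (a ⁻¹)
    mul  : ∀ {a b} → InGen g a → InGen g b → InGen g (a ∙ b)
    resp : ∀ {a b} → a ≈ b → InGen g a → InGen g b

  NormalClosureIn : ∀ {i j : Level} {I : Set i} {J : Set j} →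
                    (I → Carrier) → (J → Carrier) → Carrier → Set (c ⊔ ℓ ⊔ i ⊔ j)
  NormalClosureIn {I = I} {J = J} g h =
    InGen {I = Σ Carrier (λ k → InGen g k) × J} (λ { ((k , _) , j) → conj (h j) k })

module Submission where

-- Every factorization Hurwitz equivalent to F₁ has the following shape: each entry is
-- either (u, 1) with u ∈ N, or (v ^ ν, z) with v ∈ K, ν ∈ N and z ≠ 1; the trivial entries
-- are, up to order, K-conjugates of x₁, …, xₙ; and the pairs (v, z) of the nontrivial
-- entries are the image of ((y₁, z₁), …, (yₘ, zₘ)) under some braid of B_m.  Each Hurwitz
-- move preserves this shape: a move involving a trivial entry conjugates it by an element
-- of K or multiplies a twist ν by an element of N, while a move on two nontrivial entries
-- is the same move on their pairs (v, z), and keeps them nontrivial.  Reading the shape off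
-- F₂ gives the permutation of part 1, and shows that the braid fixes (zⱼ), hence by
-- hypothesis fixes (yⱼ), which gives part 2.

open import Defs
open import Level using (Level; _⊔_)
open import Algebra.Bundles using (Group)
open import Algebra.Construct.DirectProduct using (group)
open import Data.Nat using (ℕ; zero; suc; _+_)
open import Data.Fin using (Fin; zero; suc)
open import Data.Fin.Permutation using (Permutation′; _⟨$⟩ʳ_; lift₀; transpose; _∘ₚ_; id)
open import Data.Vec using (Vec; tabulate; _++_; []; _∷_; lookup)
open import Data.Vec.Properties using (lookup∘tabulate)
open import Data.Vec.Relation.Binary.Pointwise.Inductive as Pointwise using (Pointwise; []; _∷_)
open import Data.List as List using (_∷_; [])
open import Data.Sum using ([_,_]; inj₁; inj₂)
open import Data.Product using (Σ; _×_; _,_; proj₁; proj₂)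
open import Data.Bool using (Bool; true; false)
open import Data.Empty using (⊥-elim)
open import Relation.Nullary using (¬_)
open import Relation.Binary.PropositionalEquality as ≡ using (_≡_; subst₂)

module ConjugationProperties {c ℓ : Level} (H : Group c ℓ) where
  open Group H
  open import Algebra.Properties.Group H
    using (ε⁻¹≈ε; ⁻¹-involutive; ⁻¹-anti-homo-∙; \\-leftDividesˡ)
  open import Relation.Binary.Reasoning.Setoid setoid

  infixl 8 _^_
  _^_ : Carrier → Carrier → Carrier
  _^_ = conj H

  infix 4 _∼[_]_
  _∼[_]_ : ∀ {p} → Carrier → (Carrier → Set p) → Carrier → Set (c ⊔ ℓ ⊔ p)
  a ∼[ P ] b = Σ Carrier λ k → P k × a ≈ b ^ k

  ∼-respˡ : ∀ {p} {P : Carrier → Set p} {a a′ b} → a ≈ a′ → a ∼[ P ] b → a′ ∼[ P ] b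
  ∼-respˡ a≈a′ (k , k∈P , a≈bᵏ) = k , k∈P , trans (sym a≈a′) a≈bᵏ

  ∼-respʳ : ∀ {p} {P : Carrier → Set p} {a b b′} → b ≈ b′ → a ∼[ P ] b → a ∼[ P ] b′
  ∼-respʳ b≈b′ (k , k∈P , a≈bᵏ) = k , k∈P , trans a≈bᵏ (∙-congʳ (∙-congˡ b≈b′))

  ^-cong : ∀ {a a′ b b′} → a ≈ a′ → b ≈ b′ → a ^ b ≈ a′ ^ b′
  ^-cong a≈a′ b≈b′ = ∙-cong (∙-cong (⁻¹-cong b≈b′) a≈a′) b≈b′

  ε-^ : ∀ b → ε ^ b ≈ ε
  ε-^ b = trans (∙-congʳ (identityʳ (b ⁻¹))) (inverseˡ b)

  ≈ε⇒^≈ε : ∀ {a} b → a ≈ ε → a ^ b ≈ ε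
  ≈ε⇒^≈ε b a≈ε = trans (^-cong a≈ε refl) (ε-^ b)

  ^-ε : ∀ a → a ^ ε ≈ a
  ^-ε a = begin
    (ε ⁻¹ ∙ a) ∙ ε ≈⟨ identityʳ _ ⟩
    ε ⁻¹ ∙ a       ≈⟨ ∙-congʳ ε⁻¹≈ε ⟩
    ε ∙ a          ≈⟨ identityˡ a ⟩
    a              ∎

  ^-^ : ∀ a b k → a ^ b ^ k ≈ a ^ (b ∙ k)
  ^-^ a b k = begin
    (k ⁻¹ ∙ ((b ⁻¹ ∙ a) ∙ b)) ∙ k ≈⟨ assoc _ _ _ ⟩
    k ⁻¹ ∙ (((b ⁻¹ ∙ a) ∙ b) ∙ k) ≈⟨ ∙-congˡ (assoc _ _ _) ⟩
    k ⁻¹ ∙ ((b ⁻¹ ∙ a) ∙ (b ∙ k)) ≈⟨ ∙-congˡ (assoc _ _ _) ⟩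
    k ⁻¹ ∙ (b ⁻¹ ∙ (a ∙ (b ∙ k))) ≈⟨ assoc _ _ _ ⟨
    (k ⁻¹ ∙ b ⁻¹) ∙ (a ∙ (b ∙ k)) ≈⟨ assoc _ _ _ ⟨
    ((k ⁻¹ ∙ b ⁻¹) ∙ a) ∙ (b ∙ k) ≈⟨ ∙-congʳ (∙-congʳ (⁻¹-anti-homo-∙ b k)) ⟨
    ((b ∙ k) ⁻¹ ∙ a) ∙ (b ∙ k)    ∎

  ^-distrib-∙ : ∀ a b k → (a ∙ b) ^ k ≈ a ^ k ∙ b ^ k
  ^-distrib-∙ a b k = begin
    (k ⁻¹ ∙ (a ∙ b)) ∙ k                 ≈⟨ ∙-congʳ (assoc _ _ _) ⟨
    ((k ⁻¹ ∙ a) ∙ b) ∙ k                 ≈⟨ ∙-congʳ (∙-congˡ (\\-leftDividesˡ k b)) ⟨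
    ((k ⁻¹ ∙ a) ∙ (k ∙ (k ⁻¹ ∙ b))) ∙ k ≈⟨ ∙-congʳ (assoc _ _ _) ⟨
    (((k ⁻¹ ∙ a) ∙ k) ∙ (k ⁻¹ ∙ b)) ∙ k ≈⟨ assoc _ _ _ ⟩
    ((k ⁻¹ ∙ a) ∙ k) ∙ ((k ⁻¹ ∙ b) ∙ k) ∎

  ^-distrib-⁻¹ : ∀ a k → (a ⁻¹) ^ k ≈ (a ^ k) ⁻¹
  ^-distrib-⁻¹ a k = begin
    (k ⁻¹ ∙ a ⁻¹) ∙ k           ≈⟨ assoc _ _ _ ⟩
    k ⁻¹ ∙ (a ⁻¹ ∙ k)           ≈⟨ ∙-congˡ (∙-congˡ (⁻¹-involutive k)) ⟨
    k ⁻¹ ∙ (a ⁻¹ ∙ k ⁻¹ ⁻¹)     ≈⟨ ∙-congˡ (⁻¹-anti-homo-∙ _ _) ⟨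
    k ⁻¹ ∙ (k ⁻¹ ∙ a) ⁻¹        ≈⟨ ⁻¹-anti-homo-∙ _ _ ⟨
    ((k ⁻¹ ∙ a) ∙ k) ⁻¹         ∎

  x∙y^x≈y∙x : ∀ a b → a ∙ b ^ a ≈ b ∙ a
  x∙y^x≈y∙x a b = begin
    a ∙ ((a ⁻¹ ∙ b) ∙ a) ≈⟨ assoc _ _ _ ⟨
    (a ∙ (a ⁻¹ ∙ b)) ∙ a ≈⟨ ∙-congʳ (\\-leftDividesˡ a b) ⟩
    b ∙ a                ∎

  ^≈ε⇒≈ε : ∀ {a} b → a ^ b ≈ ε → a ≈ ε
  ^≈ε⇒≈ε {a} b aᵇ≈ε = begin
    a                  ≈⟨ identityʳ a ⟨
    a ∙ ε              ≈⟨ ∙-congˡ (inverseʳ b) ⟨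
    a ∙ (b ∙ b ⁻¹)     ≈⟨ assoc _ _ _ ⟨
    (a ∙ b) ∙ b ⁻¹     ≈⟨ ∙-congʳ (x∙y^x≈y∙x b a) ⟨
    (b ∙ a ^ b) ∙ b ⁻¹ ≈⟨ ∙-congʳ (∙-congˡ aᵇ≈ε) ⟩
    (b ∙ ε) ∙ b ⁻¹     ≈⟨ ∙-congʳ (identityʳ b) ⟩
    b ∙ b ⁻¹           ≈⟨ inverseʳ b ⟩
    ε                  ∎

  x∙y∙x⁻¹≈y^x⁻¹ : ∀ a b → (a ∙ b) ∙ a ⁻¹ ≈ b ^ (a ⁻¹)
  x∙y∙x⁻¹≈y^x⁻¹ a b = ∙-congʳ (∙-congʳ (sym (⁻¹-involutive a)))

  ≈ε⇒x∙y∙x⁻¹≈y : ∀ {a} b → a ≈ ε → (a ∙ b) ∙ a ⁻¹ ≈ b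
  ≈ε⇒x∙y∙x⁻¹≈y {a} b a≈ε = begin
    (a ∙ b) ∙ a ⁻¹ ≈⟨ x∙y∙x⁻¹≈y^x⁻¹ a b ⟩
    b ^ (a ⁻¹)     ≈⟨ ^-cong refl (trans (⁻¹-cong a≈ε) ε⁻¹≈ε) ⟩
    b ^ ε          ≈⟨ ^-ε b ⟩
    b              ∎

  ∙-^-shift : ∀ a b k → a ∙ b ^ k ≈ b ∙ ((a ∙ k ⁻¹) ^ b ∙ k)
  ∙-^-shift a b k = begin
    a ∙ ((k ⁻¹ ∙ b) ∙ k)      ≈⟨ assoc _ _ _ ⟨
    (a ∙ (k ⁻¹ ∙ b)) ∙ k      ≈⟨ ∙-congʳ (assoc _ _ _) ⟨
    ((a ∙ k ⁻¹) ∙ b) ∙ k      ≈⟨ ∙-congʳ (x∙y^x≈y∙x b _) ⟨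
    (b ∙ (a ∙ k ⁻¹) ^ b) ∙ k  ≈⟨ assoc _ _ _ ⟩
    b ∙ ((a ∙ k ⁻¹) ^ b ∙ k)  ∎

  -- The Hurwitz moves applied to u ^ ν, v ^ μ are the moves applied to u, v, conjugated
  -- by an element of any subgroup that contains ν and μ and is normalised by u and v.
  ^-σ-twisted : ∀ u v ν μ → (u ^ ν) ^ (v ^ μ) ≈ (u ^ v) ^ ((ν ∙ μ ⁻¹) ^ v ∙ μ)
  ^-σ-twisted u v ν μ = begin
    (u ^ ν) ^ (v ^ μ)                ≈⟨ ^-^ u ν (v ^ μ) ⟩
    u ^ (ν ∙ v ^ μ)                  ≈⟨ ^-cong refl (∙-^-shift ν v μ) ⟩
    u ^ (v ∙ ((ν ∙ μ ⁻¹) ^ v ∙ μ))   ≈⟨ ^-^ u v _ ⟨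
    (u ^ v) ^ ((ν ∙ μ ⁻¹) ^ v ∙ μ)   ∎

  ^-σ⁻¹-twisted : ∀ u v ν μ →
    (u ^ ν ∙ v ^ μ) ∙ (u ^ ν) ⁻¹ ≈ ((u ∙ v) ∙ u ⁻¹) ^ ((μ ∙ ν ⁻¹) ^ (u ⁻¹) ∙ ν)
  ^-σ⁻¹-twisted u v ν μ = begin
    (u ^ ν ∙ v ^ μ) ∙ (u ^ ν) ⁻¹               ≈⟨ x∙y∙x⁻¹≈y^x⁻¹ _ _ ⟩
    (v ^ μ) ^ ((u ^ ν) ⁻¹)                      ≈⟨ ^-cong refl (^-distrib-⁻¹ u ν) ⟨
    (v ^ μ) ^ ((u ⁻¹) ^ ν)                      ≈⟨ ^-^ v μ _ ⟩
    v ^ (μ ∙ (u ⁻¹) ^ ν)                        ≈⟨ ^-cong refl (∙-^-shift μ (u ⁻¹) ν) ⟩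
    v ^ (u ⁻¹ ∙ ((μ ∙ ν ⁻¹) ^ (u ⁻¹) ∙ ν))      ≈⟨ ^-^ v (u ⁻¹) _ ⟨
    (v ^ (u ⁻¹)) ^ ((μ ∙ ν ⁻¹) ^ (u ⁻¹) ∙ ν)    ≈⟨ ^-cong (x∙y∙x⁻¹≈y^x⁻¹ u v) refl ⟨
    ((u ∙ v) ∙ u ⁻¹) ^ ((μ ∙ ν ⁻¹) ^ (u ⁻¹) ∙ ν) ∎

-- BraidGen ignores its group argument, so the words of H act on tuples in any group K.
module BraidWordProperties {c ℓ : Level} (H : Group c ℓ) where

  liftᵍ : ∀ {k} → BraidGen H k → BraidGen H (suc k)
  liftᵍ {suc k} (i , s) = suc i , s

  liftʷ : ∀ {k} → BraidWord H k → BraidWord H (suc k)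
  liftʷ = List.map liftᵍ

  module _ {c′ ℓ′ : Level} (K : Group c′ ℓ′) where
    open Group K using (Carrier)

    ·ʷ-++ : ∀ {k} (v : Vec Carrier k) (w₁ w₂ : BraidWord H k) →
            _·ʷ_ K (_·ʷ_ K v w₁) w₂ ≡ _·ʷ_ K v (w₁ List.++ w₂)
    ·ʷ-++ v []       w₂ = ≡.refl
    ·ʷ-++ v (g ∷ w₁) w₂ = ·ʷ-++ (gen-act K v g) w₁ w₂

    ·ʷ-liftʷ : ∀ {k} u (v : Vec Carrier k) (w : BraidWord H k) →
               _·ʷ_ K (u ∷ v) (liftʷ w) ≡ u ∷ _·ʷ_ K v w
    ·ʷ-liftʷ u v []                = ≡.refl
    ·ʷ-liftʷ {suc k} u v (g ∷ w) = ·ʷ-liftʷ u (gen-act K v g) w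

module HurwitzInvariant {c₁ ℓ₁ c₂ ℓ₂ : Level} (G₁ : Group c₁ ℓ₁) (G₂ : Group c₂ ℓ₂) {n m : ℕ}
    (x : Fin n → Group.Carrier G₁) (y : Fin m → Group.Carrier G₁) where
  open Group G₁
  open ConjugationProperties G₁
  open BraidWordProperties G₁ using (·ʷ-++; liftʷ; ·ʷ-liftʷ)
  module B = Group G₂
  module B^ = ConjugationProperties G₂

  G : Group (c₁ ⊔ c₂) (ℓ₁ ⊔ ℓ₂)
  G = group G₁ G₂

  C : Set (c₁ ⊔ c₂)
  C = Group.Carrier G

  _≈ᴳ_ : C → C → Set (ℓ₁ ⊔ ℓ₂)
  _≈ᴳ_ = Group._≈_ G

  InK : Carrier → Set (c₁ ⊔ ℓ₁)
  InK = InGen G₁ [ x , y ]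

  InN : Carrier → Set (c₁ ⊔ ℓ₁)
  InN = NormalClosureIn G₁ [ x , y ] x

  private variable
    l p q : ℕ
    a b : C
    u v ν : Carrier
    z : B.Carrier
    T : Vec C l
    X X′ X″ : Vec Carrier p
    Y : Vec Carrier q
    Z : Vec B.Carrier q

  K-^-closed : InK u → InK v → InK (u ^ v)
  K-^-closed u∈K v∈K = mul (mul (inv v∈K) u∈K) v∈K

  N⊆K : InN u → InK u
  N⊆K (gen ((k , k∈K) , i)) = K-^-closed (gen (inj₁ i)) k∈K
  N⊆K unit                  = unit
  N⊆K (inv u∈N)             = inv (N⊆K u∈N)
  N⊆K (mul u∈N v∈N)         = mul (N⊆K u∈N) (N⊆K v∈N)
  N⊆K (resp u≈v u∈N)        = resp u≈v (N⊆K u∈N)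

  N-^K-closed : InN u → InK v → InN (u ^ v)
  N-^K-closed {v = k} (gen ((k′ , k′∈K) , i)) k∈K =
    resp (sym (^-^ (x i) k′ k)) (gen ((k′ ∙ k , mul k′∈K k∈K) , i))
  N-^K-closed {v = k} unit k∈K = resp (sym (ε-^ k)) unit
  N-^K-closed {v = k} (inv {u} u∈N) k∈K =
    resp (sym (^-distrib-⁻¹ u k)) (inv (N-^K-closed u∈N k∈K))
  N-^K-closed {v = k} (mul {u} {v} u∈N v∈N) k∈K =
    resp (sym (^-distrib-∙ u v k)) (mul (N-^K-closed u∈N k∈K) (N-^K-closed v∈N k∈K))
  N-^K-closed (resp u≈v u∈N) k∈K = resp (^-cong u≈v refl) (N-^K-closed u∈N k∈K)

  ∈K-of-twisted : u ≈ v ^ ν → InN ν → InK v → InK u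
  ∈K-of-twisted u≈vᵛ ν∈N v∈K = resp (sym u≈vᵛ) (K-^-closed v∈K (N⊆K ν∈N))

  x∈N : ∀ i → InN (x i)
  x∈N i = resp (^-ε (x i)) (gen ((ε , unit) , i))

  y∈K : ∀ j → InK (y j)
  y∈K j = gen (inj₂ j)

  infix 4 _∼ᴷ_ _↭ᴷ_

  _∼ᴷ_ : Carrier → Carrier → Set (c₁ ⊔ ℓ₁)
  u ∼ᴷ v = u ∼[ InK ] v

  ∼ᴷ-reflexive : u ≈ v → u ∼ᴷ v
  ∼ᴷ-reflexive {v = v} u≈v = ε , unit , trans u≈v (sym (^-ε v))

  ∼ᴷ-trans : ∀ {w} → u ∼ᴷ v → v ∼ᴷ w → u ∼ᴷ w
  ∼ᴷ-trans (k , k∈K , u≈vᵏ) (k′ , k′∈K , v≈wᵏ′) =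
    k′ ∙ k , mul k′∈K k∈K , trans u≈vᵏ (trans (^-cong v≈wᵏ′ refl) (^-^ _ k′ k))

  record _↭ᴷ_ (X′ X : Vec Carrier p) : Set (c₁ ⊔ ℓ₁) where
    constructor _,_
    field
      permutation : Permutation′ p
      conjugate   : ∀ i → lookup X′ i ∼ᴷ lookup X (permutation ⟨$⟩ʳ i)

  ↭ᴷ-refl : X ↭ᴷ X
  ↭ᴷ-refl = id , λ i → ∼ᴷ-reflexive refl

  ↭ᴷ-trans : X″ ↭ᴷ X′ → X′ ↭ᴷ X → X″ ↭ᴷ X
  ↭ᴷ-trans (π , X″∼X′) (ρ , X′∼X) = π ∘ₚ ρ , λ i → ∼ᴷ-trans (X″∼X′ i) (X′∼X (π ⟨$⟩ʳ i))

  ↭ᴷ-prep : ∀ u → X′ ↭ᴷ X → u ∷ X′ ↭ᴷ u ∷ X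
  ↭ᴷ-prep u (π , X′∼X) = lift₀ π , λ { zero → ∼ᴷ-reflexive refl ; (suc i) → X′∼X i }

  ↭ᴷ-head : u ∼ᴷ v → u ∷ X ↭ᴷ v ∷ X
  ↭ᴷ-head u∼v = id , λ { zero → u∼v ; (suc i) → ∼ᴷ-reflexive refl }

  ↭ᴷ-swap : u ∷ v ∷ X ↭ᴷ v ∷ u ∷ X
  ↭ᴷ-swap = transpose zero (suc zero) , λ
    { zero          → ∼ᴷ-reflexive refl
    ; (suc zero)    → ∼ᴷ-reflexive refl
    ; (suc (suc i)) → ∼ᴷ-reflexive refl
    }

  -- The entries (u, 1) of T are listed in X, with u ∈ N; every other entry is
  -- (v ^ ν, z) with v ∈ K, ν ∈ N, z ≠ 1, and (Y, Z) lists the pairs (v, z).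
  data Split : Vec C l → Vec Carrier p → Vec Carrier q → Vec B.Carrier q →
               Set (c₁ ⊔ ℓ₁ ⊔ c₂ ⊔ ℓ₂) where
    []      : Split [] [] [] []
    trivial : proj₂ a B.≈ B.ε → proj₁ a ≈ u → InN u →
              Split T X Y Z → Split (a ∷ T) (u ∷ X) Y Z
    twisted : proj₁ a ≈ v ^ ν → InN ν → InK v → proj₂ a B.≈ z → ¬ z B.≈ B.ε →
              Split T X Y Z → Split (a ∷ T) X (v ∷ Y) (z ∷ Z)

  SplitsFrom : Vec C l → Vec Carrier p → Vec Carrier q → Vec B.Carrier q →
               Set (c₁ ⊔ ℓ₁ ⊔ c₂ ⊔ ℓ₂)
  SplitsFrom {p = p} {q = q} T X Y Z = Σ (Vec Carrier p) λ X′ → Σ (BraidWord G₁ q) λ w →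
    X′ ↭ᴷ X × Split T X′ (_·ʷ_ G₁ Y w) (_·ʷ_ G₂ Z w)

  σ-step : Split (a ∷ b ∷ T) X Y Z → SplitsFrom (σ-act G zero true (a ∷ b ∷ T)) X Y Z
  σ-step (trivial a₂≈ε a₁≈u u∈N (trivial b₂≈ε b₁≈v v∈N split)) =
    _ , [] , ↭ᴷ-trans (↭ᴷ-prep _ (↭ᴷ-head (_ , N⊆K v∈N , refl))) ↭ᴷ-swap ,
    trivial b₂≈ε b₁≈v v∈N
      (trivial (B^.≈ε⇒^≈ε _ a₂≈ε) (^-cong a₁≈u b₁≈v) (N-^K-closed u∈N (N⊆K v∈N)) split)
  σ-step (trivial a₂≈ε a₁≈u u∈N (twisted b₁≈vᵛ ν∈N v∈K b₂≈z z≢ε split)) =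
    _ , [] , ↭ᴷ-head (_ , b₁∈K , refl) ,
    twisted b₁≈vᵛ ν∈N v∈K b₂≈z z≢ε
      (trivial (B^.≈ε⇒^≈ε _ a₂≈ε) (^-cong a₁≈u refl) (N-^K-closed u∈N b₁∈K) split)
    where b₁∈K = ∈K-of-twisted b₁≈vᵛ ν∈N v∈K
  σ-step (twisted a₁≈uᵛ ν∈N u∈K a₂≈z z≢ε (trivial b₂≈ε b₁≈v v∈N split)) =
    _ , [] , ↭ᴷ-refl ,
    trivial b₂≈ε b₁≈v v∈N
      (twisted (trans (^-cong a₁≈uᵛ b₁≈v) (^-^ _ _ _)) (mul ν∈N v∈N) u∈K
               (B.trans (B^.^-cong a₂≈z b₂≈ε) (B^.^-ε _)) z≢ε split)
  σ-step (twisted a₁≈uᵛ ν∈N u∈K a₂≈z z≢ε (twisted b₁≈vᵘ μ∈N v∈K b₂≈z′ z′≢ε split)) =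
    _ , (zero , true) ∷ [] , ↭ᴷ-refl ,
    twisted b₁≈vᵘ μ∈N v∈K b₂≈z′ z′≢ε
      (twisted (trans (^-cong a₁≈uᵛ b₁≈vᵘ) (^-σ-twisted _ _ _ _))
               (mul (N-^K-closed (mul ν∈N (inv μ∈N)) v∈K) μ∈N) (K-^-closed u∈K v∈K)
               (B^.^-cong a₂≈z b₂≈z′) (λ zᶻ′≈ε → z≢ε (B^.^≈ε⇒≈ε _ zᶻ′≈ε)) split)

  σ⁻¹-step : Split (a ∷ b ∷ T) X Y Z → SplitsFrom (σ-act G zero false (a ∷ b ∷ T)) X Y Z
  σ⁻¹-step (trivial a₂≈ε a₁≈u u∈N (trivial b₂≈ε b₁≈v v∈N split)) =
    _ , [] , ↭ᴷ-trans (↭ᴷ-head (_ , inv (N⊆K u∈N) , x∙y∙x⁻¹≈y^x⁻¹ _ _)) ↭ᴷ-swap ,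
    trivial (B.trans (B^.x∙y∙x⁻¹≈y^x⁻¹ _ _) (B^.≈ε⇒^≈ε _ b₂≈ε))
            (∙-cong (∙-cong a₁≈u b₁≈v) (⁻¹-cong a₁≈u)) (mul (mul u∈N v∈N) (inv u∈N))
      (trivial a₂≈ε a₁≈u u∈N split)
  σ⁻¹-step (trivial a₂≈ε a₁≈u u∈N (twisted b₁≈vᵘ μ∈N v∈K b₂≈z z≢ε split)) =
    _ , [] , ↭ᴷ-refl ,
    twisted (trans (x∙y∙x⁻¹≈y^x⁻¹ _ _) (trans (^-cong b₁≈vᵘ (⁻¹-cong a₁≈u)) (^-^ _ _ _)))
            (mul μ∈N (inv u∈N)) v∈K (B.trans (B^.≈ε⇒x∙y∙x⁻¹≈y _ a₂≈ε) b₂≈z) z≢ε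
      (trivial a₂≈ε a₁≈u u∈N split)
  σ⁻¹-step (twisted a₁≈uᵛ ν∈N u∈K a₂≈z z≢ε (trivial b₂≈ε b₁≈v v∈N split)) =
    _ , [] , ↭ᴷ-head (_ , inv a₁∈K , refl) ,
    trivial (B.trans (B^.x∙y∙x⁻¹≈y^x⁻¹ _ _) (B^.≈ε⇒^≈ε _ b₂≈ε))
            (trans (x∙y∙x⁻¹≈y^x⁻¹ _ _) (^-cong b₁≈v refl)) (N-^K-closed v∈N (inv a₁∈K))
      (twisted a₁≈uᵛ ν∈N u∈K a₂≈z z≢ε split)
    where a₁∈K = ∈K-of-twisted a₁≈uᵛ ν∈N u∈K
  σ⁻¹-step (twisted a₁≈uᵛ ν∈N u∈K a₂≈z z≢ε (twisted b₁≈vᵘ μ∈N v∈K b₂≈z′ z′≢ε split)) =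
    _ , (zero , false) ∷ [] , ↭ᴷ-refl ,
    twisted (trans (∙-cong (∙-cong a₁≈uᵛ b₁≈vᵘ) (⁻¹-cong a₁≈uᵛ)) (^-σ⁻¹-twisted _ _ _ _))
            (mul (N-^K-closed (mul μ∈N (inv ν∈N)) (inv u∈K)) ν∈N) (mul (mul u∈K v∈K) (inv u∈K))
            (B.∙-cong (B.∙-cong a₂≈z b₂≈z′) (B.⁻¹-cong a₂≈z))
            (λ e → z′≢ε (B^.^≈ε⇒≈ε _ (B.trans (B.sym (B^.x∙y∙x⁻¹≈y^x⁻¹ _ _)) e)))
      (twisted a₁≈uᵛ ν∈N u∈K a₂≈z z≢ε split)

  braid-step : (i : Fin l) (s : Bool) → Split T X Y Z → SplitsFrom (σ-act G i s T) X Y Z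
  braid-step {T = _ ∷ _ ∷ _} zero true  split = σ-step split
  braid-step {T = _ ∷ _ ∷ _} zero false split = σ⁻¹-step split
  braid-step (suc i) s (trivial a₂≈ε a₁≈u u∈N split) with braid-step i s split
  ... | X′ , w , X′↭X , split′ = _ , w , ↭ᴷ-prep _ X′↭X , trivial a₂≈ε a₁≈u u∈N split′
  braid-step (suc i) s (twisted {v = v} {z = z} a₁≈vᵛ ν∈N v∈K a₂≈z z≢ε split)
    with braid-step i s split
  ... | X′ , w , X′↭X , split′ = X′ , liftʷ w , X′↭X ,
    subst₂ (Split _ X′) (≡.sym (·ʷ-liftʷ G₁ v _ w)) (≡.sym (·ʷ-liftʷ G₂ z _ w))
      (twisted a₁≈vᵛ ν∈N v∈K a₂≈z z≢ε split′)

  braid-word : (w : BraidWord G l) → Split T X Y Z → SplitsFrom (_·ʷ_ G T w) X Y Z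
  braid-word [] split = _ , [] , ↭ᴷ-refl , split
  braid-word {suc l} ((i , s) ∷ w) split with braid-step i s split
  ... | X₁ , w₁ , X₁↭X , split₁ with braid-word w split₁
  ... | X₂ , w₂ , X₂↭X₁ , split₂ = X₂ , w₁ List.++ w₂ , ↭ᴷ-trans X₂↭X₁ X₁↭X ,
    subst₂ (Split _ X₂) (·ʷ-++ G₁ _ w₁ w₂) (·ʷ-++ G₂ _ w₁ w₂) split₂

  standard : (Fin p → Carrier) → (Fin q → Carrier) → (Fin q → B.Carrier) → Vec C (p + q)
  standard f g h = tabulate (λ i → f i , B.ε) ++ tabulate (λ j → g j , h j)

  split-twisteds : ∀ (g : Fin q → Carrier) h → (∀ j → InK (g j)) → (∀ j → ¬ h j B.≈ B.ε) →
                   Split (tabulate (λ j → g j , h j)) [] (tabulate g) (tabulate h)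
  split-twisteds {zero}  g h g∈K h≢ε = []
  split-twisteds {suc q} g h g∈K h≢ε =
    twisted (sym (^-ε _)) unit (g∈K zero) B.refl (h≢ε zero)
      (split-twisteds (λ j → g (suc j)) (λ j → h (suc j)) (λ j → g∈K (suc j)) (λ j → h≢ε (suc j)))

  split-standard : ∀ (f : Fin p → Carrier) (g : Fin q → Carrier) h →
                   (∀ i → InN (f i)) → (∀ j → InK (g j)) → (∀ j → ¬ h j B.≈ B.ε) →
                   Split (standard f g h) (tabulate f) (tabulate g) (tabulate h)
  split-standard {zero}  f g h f∈N g∈K h≢ε = split-twisteds g h g∈K h≢ε
  split-standard {suc p} f g h f∈N g∈K h≢ε =
    trivial B.refl refl (f∈N zero)
      (split-standard (λ i → f (suc i)) g h (λ i → f∈N (suc i)) g∈K h≢ε)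

  split-twisteds⁻¹ : ∀ (g : Fin q → Carrier) h → (∀ j → ¬ h j B.≈ B.ε) →
                     Split T X Y Z → Pointwise _≈ᴳ_ T (tabulate (λ j → g j , h j)) →
                     Pointwise B._≈_ Z (tabulate h) × (∀ j → g j ∼[ InN ] lookup Y j)
  split-twisteds⁻¹ g h h≢ε [] [] = [] , λ ()
  split-twisteds⁻¹ g h h≢ε (trivial a₂≈ε _ _ _) ((_ , a₂≈h₀) ∷ _) =
    ⊥-elim (h≢ε zero (B.trans (B.sym a₂≈h₀) a₂≈ε))
  split-twisteds⁻¹ g h h≢ε (twisted {ν = ν} a₁≈vᵛ ν∈N _ a₂≈z _ split) ((a₁≈g₀ , a₂≈h₀) ∷ T≈) =
    let Z≈h , g∼Y =
          split-twisteds⁻¹ (λ j → g (suc j)) (λ j → h (suc j)) (λ j → h≢ε (suc j)) split T≈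
    in B.trans (B.sym a₂≈z) a₂≈h₀ ∷ Z≈h ,
       λ { zero → ν , ν∈N , trans (sym a₁≈g₀) a₁≈vᵛ ; (suc j) → g∼Y j }

  split-standard⁻¹ : ∀ (f : Fin p → Carrier) (g : Fin q → Carrier) h → (∀ j → ¬ h j B.≈ B.ε) →
                     {T : Vec C (p + q)} → Split T X Y Z → Pointwise _≈ᴳ_ T (standard f g h) →
                     (∀ i → f i ≈ lookup X i) × Pointwise B._≈_ Z (tabulate h) ×
                     (∀ j → g j ∼[ InN ] lookup Y j)
  split-standard⁻¹ {zero} {X = []} f g h h≢ε split T≈ =
    (λ ()) , split-twisteds⁻¹ g h h≢ε split T≈
  split-standard⁻¹ {suc p} f g h h≢ε (trivial _ a₁≈u _ split) ((a₁≈f₀ , _) ∷ T≈) =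
    let f≈X , rest = split-standard⁻¹ (λ i → f (suc i)) g h h≢ε split T≈
    in (λ { zero → trans (sym a₁≈f₀) a₁≈u ; (suc i) → f≈X i }) , rest
  split-standard⁻¹ {suc p} f g h h≢ε (twisted _ _ _ a₂≈z z≢ε _) ((_ , a₂≈ε) ∷ _) =
    ⊥-elim (z≢ε (B.trans (B.sym a₂≈z) a₂≈ε))

  hurwitz-orbit : ∀ x′ y′ (z : Fin m → B.Carrier) →
    _≅H_ G (standard x y z) (standard x′ y′ z) → (∀ j → ¬ z j B.≈ B.ε) →
    Σ (Permutation′ n) (λ π → ∀ i → x′ i ∼ᴷ x (π ⟨$⟩ʳ i)) ×
    Σ (BraidWord G₁ m) λ w → InStab G₂ (tabulate z) w ×
                             ∀ j → y′ j ∼[ InN ] lookup (_·ʷ_ G₁ (tabulate y) w) j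
  hurwitz-orbit x′ y′ z (w , F₁w≈F₂) z≢ε =
    let X′ , v , (π , X′∼x) , split = braid-word w (split-standard x y z x∈N y∈K z≢ε)
        x′≈X′ , zv≈z , y′∼yv = split-standard⁻¹ x′ y′ z z≢ε split F₁w≈F₂
    in (π , λ i → ∼-respʳ (reflexive (lookup∘tabulate x _)) (∼-respˡ (sym (x′≈X′ i)) (X′∼x i))) ,
       v , zv≈z , y′∼yv

theorem3p2 : ∀ {c₁ ℓ₁ c₂ ℓ₂ : Level} (G₁ : Group c₁ ℓ₁) (G₂ : Group c₂ ℓ₂) (n m : ℕ)
  (x x′ : Fin n → Group.Carrier G₁) (y y′ : Fin m → Group.Carrier G₁)
  (z : Fin m → Group.Carrier G₂) →
  let G = group G₁ G₂
      F₁ = tabulate (λ i → x i , Group.ε G₂) ++ tabulate (λ j → y j , z j)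
      F₂ = tabulate (λ i → x′ i , Group.ε G₂) ++ tabulate (λ j → y′ j , z j)
      InK = InGen G₁ [ x , y ]
      InN = NormalClosureIn G₁ [ x , y ] x
  in _≅H_ G F₁ F₂ →
     (∀ j → ¬ (Group._≈_ G₂ (z j) (Group.ε G₂))) →
     (Σ (Permutation′ n) λ π → ∀ i →
        Σ (Group.Carrier G₁) λ k → InK k × Group._≈_ G₁ (x′ i) (conj G₁ (x (π ⟨$⟩ʳ i)) k))
     × ((∀ w → InStab G₂ (tabulate z) w → InStab G₁ (tabulate y) w) →
        ∀ j → Σ (Group.Carrier G₁) λ μ → InN μ × Group._≈_ G₁ (y′ j) (conj G₁ (y j) μ))
theorem3p2 G₁ G₂ n m x x′ y y′ z F₁≅F₂ z≢ε =
  let x′∼x , w , w∈Stab[z] , y′∼yw = hurwitz-orbit x′ y′ z F₁≅F₂ z≢ε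
  in x′∼x , λ Stab[z]⊆Stab[y] j →
       ∼-respʳ (trans (Pointwise.lookup (Stab[z]⊆Stab[y] w w∈Stab[z]) j)
                      (reflexive (lookup∘tabulate y j)))
               (y′∼yw j)
  where
  open HurwitzInvariant G₁ G₂ x y using (hurwitz-orbit)
  open Group G₁ using (trans; reflexive)
  open ConjugationProperties G₁ using (∼-respʳ)
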